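{- Let $K$ be a class of partial functions from tuples of natural numbers to natural numbers (possibly of different arities) satisfying the following three conditions. (1) (Closure) $K$ contains all partial recursive functions and is closed under substitution (composition), primitive recursion and the $\mu$-operator (minimization). (2) (Computation records) For every unary function $f\in K$ there exist a set $M\subseteq\mathbb{N}$ and functions $\alpha,\omega\in K$ whose domains contain $M$ such that (a) the indicator function of $M$ (equal to $1$ on $M$ and $0$ outside $M$) belongs to $K$, and (b) for all $x,y\in\mathbb{N}$, $f(x)$ is defined and equals $y$ if and only if there exists $m\in M$ with $\alpha(m)=x$ and $\omega(m)=y$. (3) (Programs) There exists a binary function $F\in K$ that is universal for the unary functions in $K$: for every unary $f\in K$ there exists $n$ such that the function $x\mapsto F(n,x)$ coincides with $f$ (as partial functions). Then there exists a set $A\subseteq\mathbb{N}$ such that $K$ is exactly the class of all partial functions that are partial recursive relative to $A$ (equivalently, all partial functions whose graph is enumeration reducible to $A\oplus\overline{A}$).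
   Context: Graphs of partial functions $g:\mathbb{N}^k\rightharpoonup\mathbb{N}$ are regarded as subsets of $\mathbb{N}$ via a standard recursive encoding of tuples. A set $X\subseteq\mathbb{N}$ is enumeration reducible to $Y\subseteq\mathbb{N}$ (in the sense of Rogers) if there is a recursively enumerable set $W$ of pairs $(x,u)$, with $u$ the canonical index of a finite set $D_u$, such that $x\in X$ iff there is $u$ with $(x,u)\in W$ and $D_u\subseteq Y$. For sets $A,B$, $A\oplus B=\{2n\mid n\in A\}\cup\{2n+1\mid n\in B\}$, and $\overline{A}$ denotes the complement of $A$ in $\mathbb{N}$. A partial function is partial recursive relative to a set $A$ if it is computable by an oracle machine with oracle $A$ (equivalently, its graph is recursively enumerable relative to $A$). -}

module Defs where

open import Data.Nat using (ℕ; zero; suc; _<_)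
open import Data.Fin using (Fin)
open import Data.Vec using (Vec; []; _∷_; lookup)
open import Data.Bool using (Bool; true; false)
open import Data.Product using (Σ; _×_; _,_)
open import Data.Sum using (_⊎_)
open import Relation.Nullary using (¬_)
open import Relation.Binary.PropositionalEquality using (_≡_)
open import Function.Bundles using (_⇔_)

-- A partial function ℕ^k ⇀ ℕ, represented by its graph (a relation).
Graph : ℕ → Set₁
Graph k = Vec ℕ k → ℕ → Set

Functional : {k : ℕ} → Graph k → Set
Functional {k} f = ∀ (xs : Vec ℕ k) (y z : ℕ) → f xs y → f xs z → y ≡ z

_≈_ : {k : ℕ} → Graph k → Graph k → Set
_≈_ {k} f g = ∀ (xs : Vec ℕ k) (y : ℕ) → f xs y ⇔ g xs y

Indicator : (ℕ → Set) → Graph 1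
Indicator S (x ∷ []) y = (S x × y ≡ 1) ⊎ (¬ S x × y ≡ 0)

ZeroF : Graph 1
ZeroF _ y = y ≡ 0

SuccF : Graph 1
SuccF (x ∷ []) y = y ≡ suc x

Proj : {k : ℕ} → Fin k → Graph k
Proj i xs y = y ≡ lookup xs i

Compose : {m k : ℕ} → Graph m → (Fin m → Graph k) → Graph k
Compose {m} f gs xs y = Σ (Vec ℕ m) λ ys → (∀ i → gs i xs (lookup ys i)) × f ys y

data PrimRec {k : ℕ} (f : Graph k) (g : Graph (suc (suc k))) : Graph (suc k) where
  pr-zero : ∀ {xs y} → f xs y → PrimRec f g (0 ∷ xs) y
  pr-suc  : ∀ {n xs z y} → PrimRec f g (n ∷ xs) z → g (n ∷ z ∷ xs) y →
            PrimRec f g (suc n ∷ xs) y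

Mu : {k : ℕ} → Graph (suc k) → Graph k
Mu f xs n = f (n ∷ xs) 0 × (∀ m → m < n → Σ ℕ λ v → f (m ∷ xs) (suc v))

-- Codes of (oracle) μ-recursive functions.  Code false k: partial recursive
-- k-ary functions; Code true k: may additionally query the oracle.

data Code : Bool → ℕ → Set where
  zer    : ∀ {o} → Code o 1
  succ   : ∀ {o} → Code o 1
  proj   : ∀ {o k} → Fin k → Code o k
  comp   : ∀ {o m k} → Code o m → (Fin m → Code o k) → Code o k
  prec   : ∀ {o k} → Code o k → Code o (suc (suc k)) → Code o (suc k)
  mu     : ∀ {o k} → Code o (suc k) → Code o k
  oracle : Code true 1

⟦_⟧ : ∀ {o k} → Code o k → (ℕ → Set) → Graph k
⟦ zer ⟧ A = ZeroF
⟦ succ ⟧ A = SuccF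
⟦ proj i ⟧ A = Proj i
⟦ comp f gs ⟧ A = Compose (⟦ f ⟧ A) (λ i → ⟦ gs i ⟧ A)
⟦ prec f g ⟧ A = PrimRec (⟦ f ⟧ A) (⟦ g ⟧ A)
⟦ mu f ⟧ A = Mu (⟦ f ⟧ A)
⟦ oracle ⟧ A = Indicator A

PartialRecursive : {k : ℕ} → Graph k → Set₁
PartialRecursive {k} f = Σ (Code false k) λ c → ∀ (A : ℕ → Set) → ⟦ c ⟧ A ≈ f

RecursiveIn : (ℕ → Set) → {k : ℕ} → Graph k → Set
RecursiveIn A {k} f = Σ (Code true k) λ c → ⟦ c ⟧ A ≈ f

Class : Set₁
Class = (k : ℕ) → Graph k → Set

-- K is a class of partial functions: members are single-valued, and
-- membership depends only on the function (its graph).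
IsClassOfPartialFunctions : Class → Set₁
IsClassOfPartialFunctions K =
  (∀ k (f : Graph k) → K k f → Functional f) ×
  (∀ k (f g : Graph k) → f ≈ g → K k f → K k g)

Closure : Class → Set₁
Closure K =
  (∀ k (f : Graph k) → PartialRecursive f → K k f) ×
  (∀ m k (f : Graph m) (gs : Fin m → Graph k) →
     K m f → (∀ i → K k (gs i)) → K k (Compose f gs)) ×
  (∀ k (f : Graph k) (g : Graph (suc (suc k))) →
     K k f → K (suc (suc k)) g → K (suc k) (PrimRec f g)) ×
  (∀ k (f : Graph (suc k)) → K (suc k) f → K k (Mu f))

ComputationRecords : Class → Set₁
ComputationRecords K =
  ∀ (f : Graph 1) → K 1 f →
    Σ (ℕ → Set) λ M → Σ (Graph 1) λ α → Σ (Graph 1) λ ω →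
      K 1 α × K 1 ω ×
      (∀ m → M m → Σ ℕ λ v → α (m ∷ []) v) ×
      (∀ m → M m → Σ ℕ λ v → ω (m ∷ []) v) ×
      K 1 (Indicator M) ×
      (∀ x y → f (x ∷ []) y ⇔ Σ ℕ λ m → M m × α (m ∷ []) x × ω (m ∷ []) y)

Programs : Class → Set₁
Programs K =
  Σ (Graph 2) λ F → K 2 F ×
    (∀ (f : Graph 1) → K 1 f →
       Σ ℕ λ n → ∀ x y → f (x ∷ []) y ⇔ F (n ∷ x ∷ []) y)

module Submission where

-- Let K satisfy (1)-(3) and let F ∈ K be the universal function.  Put
-- U(⟨a,b⟩) = F(a,b) and take computation records (M, α, ω) of U.  The oracle is
--
--   A = { ⟨m, ⟨e, y⟩⟩ | m ∈ M, α(m) = e, ω(m) = y },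
--
-- the set of computation records of U labelled with their input and output.
--
-- * A's indicator lies in K: on M the functions α, ω agree with total functions
--   α̂, ω̂ ∈ K (obtained by primitive recursion on the indicator of M), and the
--   indicator of A is a product of equality tests built from them.  As K is
--   closed under the recursion schemes, every A-recursive function lies in K.
-- * Conversely, for f ∈ K (k-ary) let n be an index of z ↦ f(decode z).  Then
--   f(xs) = y iff some w = ⟨m, ⟨⟨n, encode xs⟩, y⟩⟩ lies in A, so f is
--   computed from A by an unbounded search for w followed by reading off y.
--
-- Excluded middle is used only to decide membership in M.

open import Defs
open import Data.Nat using (ℕ; zero; suc; _+_; _*_; _∸_; _≤_; _<_; pred; z≤n; s≤s)
open import Data.Nat.Properties
open import Data.Fin using (Fin; zero; suc)
open import Data.Vec using (Vec; []; _∷_; lookup; tabulate; head; tail)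
open import Data.Vec.Properties using (tabulate∘lookup; tabulate-cong; lookup∘tabulate)
open import Data.Bool using (Bool; true; false)
open import Data.Product using (Σ; _×_; _,_; proj₁; proj₂)
open import Data.Sum using (_⊎_; inj₁; inj₂)
open import Data.Unit.Polymorphic using (⊤; tt)
open import Data.Empty using (⊥-elim)
open import Relation.Nullary using (¬_; Dec; yes; no)
open import Relation.Binary.Definitions using (tri<; tri≈; tri>)
open import Relation.Binary.PropositionalEquality
open import Function.Bundles using (_⇔_; mk⇔; module Equivalence)
open import Function.Construct.Identity using (⇔-id)
open import Function.Construct.Composition using (_⇔-∘_)
open import Function.Construct.Symmetry using (⇔-sym)
open import Axiom.ExcludedMiddle using (ExcludedMiddle)
open import Level using (0ℓ)

open Equivalence using (to; from)

data Truth (P : Set) : ℕ → Set where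
  holds : P → Truth P 1
  fails : ¬ P → Truth P 0

truth-cong : ∀ {P Q : Set} {n} → P ⇔ Q → Truth P n → Truth Q n
truth-cong P⇔Q (holds p)  = holds (to P⇔Q p)
truth-cong P⇔Q (fails ¬p) = fails (λ q → ¬p (from P⇔Q q))

truth-× : ∀ {P Q : Set} {a b} → Truth P a → Truth Q b → Truth (P × Q) (a * b)
truth-× (holds p)  (holds q)  = holds (p , q)
truth-× (holds p)  (fails ¬q) = fails (λ pq → ¬q (proj₂ pq))
truth-× (fails ¬p) _          = fails (λ pq → ¬p (proj₁ pq))

-- 1 ∸ n turns the truth value n into a search condition: it vanishes iff P.
truth-search : ∀ {P : Set} {n} → Truth P n → (1 ∸ n ≡ 0) ⇔ P
truth-search (holds p)  = mk⇔ (λ _ → p) (λ _ → refl)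
truth-search (fails ¬p) = mk⇔ (λ ()) (λ p → ⊥-elim (¬p p))

truthValue : ∀ {P : Set} → Dec P → ℕ
truthValue (yes _) = 1
truthValue (no _)  = 0

truthValue-truth : ∀ {P : Set} (d : Dec P) → Truth P (truthValue d)
truthValue-truth (yes p) = holds p
truthValue-truth (no ¬p) = fails ¬p

isZero-truth : ∀ n → Truth (n ≡ 0) (1 ∸ n)
isZero-truth zero = holds refl
isZero-truth (suc n) rewrite 0∸n≡0 n = fails (λ ())

graphOf : ∀ {k} → (Vec ℕ k → ℕ) → Graph k
graphOf φ xs y = y ≡ φ xs

fun₁ : (ℕ → ℕ) → Vec ℕ 1 → ℕ
fun₁ f v = f (head v)

fun₂ : (ℕ → ℕ → ℕ) → Vec ℕ 2 → ℕ
fun₂ f v = f (head v) (head (tail v))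

fun₃ : (ℕ → ℕ → ℕ → ℕ) → Vec ℕ 3 → ℕ
fun₃ f v = f (head v) (head (tail v)) (head (tail (tail v)))

≈-refl : ∀ {k} {f : Graph k} → f ≈ f
≈-refl xs y = ⇔-id _

≈-sym : ∀ {k} {f g : Graph k} → f ≈ g → g ≈ f
≈-sym f≈g xs y = ⇔-sym (f≈g xs y)

indicator-truth : ∀ {S : ℕ → Set} {χ : ℕ → ℕ} → (∀ x → Truth (S x) (χ x)) →
  Indicator S ≈ graphOf (fun₁ χ)
indicator-truth {S} {χ} truth (x ∷ []) y = mk⇔ (forward (truth x)) (backward (truth x))
  where
  forward : ∀ {n} → Truth (S x) n → Indicator S (x ∷ []) y → y ≡ n
  forward (holds _)  (inj₁ (_ , y≡1))  = y≡1
  forward (holds s)  (inj₂ (¬s , _))   = ⊥-elim (¬s s)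
  forward (fails ¬s) (inj₁ (s , _))    = ⊥-elim (¬s s)
  forward (fails _)  (inj₂ (_ , y≡0))  = y≡0
  backward : ∀ {n} → Truth (S x) n → y ≡ n → Indicator S (x ∷ []) y
  backward (holds s)  y≡1 = inj₁ (s , y≡1)
  backward (fails ¬s) y≡0 = inj₂ (¬s , y≡0)

compose-total : ∀ {m k} (f : Graph m) {gs : Fin m → Graph k} {ψ : Fin m → Vec ℕ k → ℕ} →
  (∀ i → gs i ≈ graphOf (ψ i)) →
  ∀ xs y → Compose f gs xs y ⇔ f (tabulate λ i → ψ i xs) y
compose-total f {gs} {ψ} gs≈ψ xs y = mk⇔ forward backward
  where
  values : Vec ℕ _
  values = tabulate λ i → ψ i xs
  forward : Compose f gs xs y → f values y
  forward (ys , gs-ys , f-ys) = subst (λ v → f v y) ys≡values f-ys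
    where
    ys≡values : ys ≡ values
    ys≡values = trans (sym (tabulate∘lookup ys))
                      (tabulate-cong λ i → to (gs≈ψ i xs _) (gs-ys i))
  backward : f values y → Compose f gs xs y
  backward f-values = values , (λ i → from (gs≈ψ i xs _) (lookup∘tabulate _ i)) , f-values

args₁ : ∀ {ℓ} {X : Set ℓ} → X → Fin 1 → X
args₁ a zero = a

args₂ : ∀ {ℓ} {X : Set ℓ} → X → X → Fin 2 → X
args₂ a b zero       = a
args₂ a b (suc zero) = b

record TotalCode (o : Bool) (Good : (ℕ → Set) → Set₁) (k : ℕ) (φ : Vec ℕ k → ℕ) : Set₁ where
  field
    code     : Code o k
    computes : ∀ A → Good A → ⟦ code ⟧ A ≈ graphOf φ
open TotalCode public

-- φ is a total recursive function: it has codes of every kind that are correct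
-- under every oracle (at o = false this is an oracle-free code for φ).
TotalRecursive : (k : ℕ) → (Vec ℕ k → ℕ) → Set₂
TotalRecursive k φ = ∀ {o Good} → TotalCode o Good k φ

primRec : ∀ {k} → (Vec ℕ k → ℕ) → (Vec ℕ (suc (suc k)) → ℕ) → Vec ℕ (suc k) → ℕ
primRec φ ψ (zero ∷ xs)  = φ xs
primRec φ ψ (suc n ∷ xs) = ψ (n ∷ primRec φ ψ (n ∷ xs) ∷ xs)

module _ {o : Bool} {Good : (ℕ → Set) → Set₁} where

  cast : ∀ {k} {φ ψ : Vec ℕ k → ℕ} → TotalCode o Good k φ → (∀ xs → φ xs ≡ ψ xs) →
    TotalCode o Good k ψ
  cast t φ≡ψ = record
    { code = code t
    ; computes = λ A good xs y →
        mk⇔ (λ c → trans (to (computes t A good xs y) c) (φ≡ψ xs))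
            (λ y≡ψ → from (computes t A good xs y) (trans y≡ψ (sym (φ≡ψ xs)))) }

  compose : ∀ {m k} {φ : Vec ℕ m → ℕ} {ψ : Fin m → Vec ℕ k → ℕ} →
    TotalCode o Good m φ → (∀ i → TotalCode o Good k (ψ i)) →
    TotalCode o Good k (λ xs → φ (tabulate λ i → ψ i xs))
  compose tf tgs = record
    { code = comp (code tf) (λ i → code (tgs i))
    ; computes = λ A good xs y →
        computes tf A good _ y
          ⇔-∘ compose-total (⟦ code tf ⟧ A) (λ i → computes (tgs i) A good) xs y }

  _∘₁_ : ∀ {k} {φ : Vec ℕ 1 → ℕ} {g : Vec ℕ k → ℕ} →
    TotalCode o Good 1 φ → TotalCode o Good k g → TotalCode o Good k (λ xs → φ (g xs ∷ []))
  _∘₁_ {g = g} tf tg = compose {ψ = args₁ g} tf λ { zero → tg }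

  _∘₂⟨_,_⟩ : ∀ {k} {φ : Vec ℕ 2 → ℕ} {g h : Vec ℕ k → ℕ} →
    TotalCode o Good 2 φ → TotalCode o Good k g → TotalCode o Good k h →
    TotalCode o Good k (λ xs → φ (g xs ∷ h xs ∷ []))
  _∘₂⟨_,_⟩ {g = g} {h} tf tg th = compose {ψ = args₂ g h} tf λ { zero → tg ; (suc zero) → th }

  primRec-code : ∀ {k} {φ : Vec ℕ k → ℕ} {ψ : Vec ℕ (suc (suc k)) → ℕ} →
    TotalCode o Good k φ → TotalCode o Good (suc (suc k)) ψ →
    TotalCode o Good (suc k) (primRec φ ψ)
  primRec-code {φ = φ} {ψ} tf tg = record
    { code = prec (code tf) (code tg)
    ; computes = λ A good xs y → mk⇔ (forward A good) (backward A good xs y) }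
    where
    forward : ∀ A → Good A → ∀ {xs y} →
      PrimRec (⟦ code tf ⟧ A) (⟦ code tg ⟧ A) xs y → y ≡ primRec φ ψ xs
    forward A good (pr-zero f-y) = to (computes tf A good _ _) f-y
    forward A good (pr-suc prev g-y) with forward A good prev
    ... | refl = to (computes tg A good _ _) g-y
    backward : ∀ A → Good A → ∀ xs y →
      y ≡ primRec φ ψ xs → PrimRec (⟦ code tf ⟧ A) (⟦ code tg ⟧ A) xs y
    backward A good (zero ∷ xs) y y≡ = pr-zero (from (computes tf A good xs y) y≡)
    backward A good (suc n ∷ xs) y y≡ =
      pr-suc (backward A good (n ∷ xs) _ refl) (from (computes tg A good _ y) y≡)

  proj-code : ∀ {k} (i : Fin k) → TotalCode o Good k (λ xs → lookup xs i)
  proj-code i = record { code = proj i ; computes = λ A good → ≈-refl }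

  dropFirst : ∀ {k} {φ : Vec ℕ k → ℕ} → TotalCode o Good k φ →
    TotalCode o Good (suc k) (λ v → φ (tail v))
  dropFirst {φ = φ} t = cast (compose {ψ = λ i v → lookup v (suc i)} t λ i → proj-code (suc i))
    λ { (x ∷ xs) → cong φ (tabulate∘lookup xs) }

zero-code : TotalRecursive 1 (λ _ → 0)
zero-code = record { code = zer ; computes = λ A good → ≈-refl }

succ-code : TotalRecursive 1 (fun₁ suc)
succ-code = record { code = succ ; computes = λ { A good (x ∷ []) y → ⇔-id _ } }

arg₀ : ∀ {k} → TotalRecursive (suc k) head
arg₀ = cast (proj-code zero) λ { (x ∷ xs) → refl }

arg₁ : ∀ {k} → TotalRecursive (suc (suc k)) (λ v → head (tail v))
arg₁ = cast (proj-code (suc zero)) λ { (x ∷ y ∷ xs) → refl }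

arg₂ : ∀ {k} → TotalRecursive (suc (suc (suc k))) (λ v → head (tail (tail v)))
arg₂ = cast (proj-code (suc (suc zero))) λ { (x ∷ y ∷ z ∷ xs) → refl }

const-code : ∀ {k} c → TotalRecursive (suc k) (λ _ → c)
const-code zero    = zero-code ∘₁ arg₀
const-code (suc c) = succ-code ∘₁ const-code c

rec : (ℕ → ℕ) → (ℕ → ℕ → ℕ → ℕ) → ℕ → ℕ → ℕ
rec b h n x = primRec (fun₁ b) (fun₃ h) (n ∷ x ∷ [])

recursion : (f : ℕ → ℕ → ℕ) {b : ℕ → ℕ} {h : ℕ → ℕ → ℕ → ℕ} →
  (∀ x → f 0 x ≡ b x) → (∀ n x → f (suc n) x ≡ h n (f n x) x) →
  TotalRecursive 1 (fun₁ b) → TotalRecursive 3 (fun₃ h) → TotalRecursive 2 (fun₂ f)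
recursion f {b} {h} base step tb th =
  cast (primRec-code tb th) λ { (n ∷ x ∷ []) → sym (f≡rec n x) }
  where
  f≡rec : ∀ n x → f n x ≡ rec b h n x
  f≡rec zero    x = base x
  f≡rec (suc n) x = trans (step n x) (cong (λ a → h n a x) (f≡rec n x))

iteration : (f : ℕ → ℕ) {c : ℕ} {h : ℕ → ℕ → ℕ} →
  f 0 ≡ c → (∀ n → f (suc n) ≡ h n (f n)) →
  TotalRecursive 2 (fun₂ h) → TotalRecursive 1 (fun₁ f)
iteration f {c} {h} base step th =
  recursion (λ n _ → f n) {h = λ n a _ → h n a} (λ _ → base) (λ n _ → step n)
            (const-code c) (th ∘₂⟨ arg₀ , arg₁ ⟩)
    ∘₂⟨ arg₀ , arg₀ ⟩

pred-code : TotalRecursive 1 (fun₁ pred)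
pred-code = iteration pred {h = λ n _ → n} refl (λ _ → refl) arg₀

∸-code : TotalRecursive 2 (fun₂ _∸_)
∸-code = flipped ∘₂⟨ arg₁ , arg₀ ⟩
  where
  flipped : TotalRecursive 2 (fun₂ λ n x → x ∸ n)
  flipped = recursion (λ n x → x ∸ n) {h = λ _ a _ → pred a}
              (λ _ → refl) (λ n x → sym (pred[m∸n]≡m∸[1+n] x n)) arg₀ (pred-code ∘₁ arg₁)

+-code : TotalRecursive 2 (fun₂ _+_)
+-code = recursion _+_ {h = λ _ a _ → suc a} (λ _ → refl) (λ _ _ → refl) arg₀ (succ-code ∘₁ arg₁)

*-code : TotalRecursive 2 (fun₂ _*_)
*-code = recursion _*_ {h = λ _ a x → x + a} (λ _ → refl) (λ _ _ → refl)
           (const-code 0) (+-code ∘₂⟨ arg₂ , arg₁ ⟩)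

dist : ℕ → ℕ → ℕ
dist x y = (x ∸ y) + (y ∸ x)

eq : ℕ → ℕ → ℕ
eq x y = 1 ∸ dist x y

dist≡0⇔≡ : ∀ x y → dist x y ≡ 0 ⇔ x ≡ y
dist≡0⇔≡ x y = mk⇔ forward backward
  where
  forward : dist x y ≡ 0 → x ≡ y
  forward d≡0 = ≤-antisym (m∸n≡0⇒m≤n (m+n≡0⇒m≡0 (x ∸ y) d≡0))
                          (m∸n≡0⇒m≤n (m+n≡0⇒n≡0 (x ∸ y) d≡0))
  backward : x ≡ y → dist x y ≡ 0
  backward refl = cong₂ _+_ (n∸n≡0 x) (n∸n≡0 x)

eq-truth : ∀ x y → Truth (x ≡ y) (eq x y)
eq-truth x y = truth-cong (dist≡0⇔≡ x y) (isZero-truth (dist x y))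

eq-code : TotalRecursive 2 (fun₂ eq)
eq-code = ∸-code ∘₂⟨ const-code 1 , +-code ∘₂⟨ ∸-code ∘₂⟨ arg₀ , arg₁ ⟩ , ∸-code ∘₂⟨ arg₁ , arg₀ ⟩ ⟩ ⟩

-- Cantor pairing ⟨a, b⟩ and coding of tuples by iterated pairing.

-- The triangular numbers 0, 1, 3, 6, ...: triangle d is the first element of
-- the d-th diagonal.
triangle : ℕ → ℕ
triangle zero    = 0
triangle (suc n) = triangle n + suc n

-- The pair ⟨a, b⟩ is the a-th element of the (a + b)-th diagonal.
pair : ℕ → ℕ → ℕ
pair a b = triangle (a + b) + a

-- The diagonal containing z, i.e. the d with triangle d ≤ z < triangle (d + 1).
diagonal : ℕ → ℕ
diagonal zero    = 0
diagonal (suc z) = diagonal z + eq (triangle (suc (diagonal z))) (suc z)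

unpair₁ : ℕ → ℕ
unpair₁ z = z ∸ triangle (diagonal z)

unpair₂ : ℕ → ℕ
unpair₂ z = diagonal z ∸ unpair₁ z

triangle-mono : ∀ {m n} → m ≤ n → triangle m ≤ triangle n
triangle-mono z≤n       = z≤n
triangle-mono (s≤s m≤n) = +-mono-≤ (triangle-mono m≤n) (s≤s m≤n)

OnDiagonal : ℕ → ℕ → Set
OnDiagonal d z = triangle d ≤ z × z < triangle (suc d)

diagonal-correct : ∀ z → OnDiagonal (diagonal z) z
diagonal-correct zero    = z≤n , s≤s z≤n
diagonal-correct (suc z) =
  next (diagonal-correct z) (eq-truth (triangle (suc (diagonal z))) (suc z))
  where
  -- Passing from z to z + 1 moves to the next diagonal exactly when z + 1
  -- is the first element of that diagonal.
  next : ∀ {d t} → OnDiagonal d z → Truth (triangle (suc d) ≡ suc z) t →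
    OnDiagonal (d + t) (suc z)
  next {d} (_ , _) (holds first) rewrite +-comm d 1 =
    ≤-reflexive first ,
    subst (_< triangle (suc (suc d))) first (m<m+n (triangle (suc d)) (s≤s z≤n))
  next {d} (lower , upper) (fails ¬first) rewrite +-identityʳ d =
    m≤n⇒m≤1+n lower , ≤∧≢⇒< upper (λ first → ¬first (sym first))

diagonal-unique : ∀ {d d' z} → OnDiagonal d z → OnDiagonal d' z → d ≡ d'
diagonal-unique {d} {d'} (lower , upper) (lower' , upper') with <-cmp d d'
... | tri< d<d' _ _ = ⊥-elim (<-irrefl refl (<-≤-trans upper (≤-trans (triangle-mono d<d') lower')))
... | tri≈ _ d≡d' _ = d≡d'
... | tri> _ _ d>d' = ⊥-elim (<-irrefl refl (<-≤-trans upper' (≤-trans (triangle-mono d>d') lower)))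

diagonal-pair : ∀ a b → diagonal (pair a b) ≡ a + b
diagonal-pair a b = diagonal-unique (diagonal-correct (pair a b))
  (m≤m+n (triangle (a + b)) a , +-monoʳ-< (triangle (a + b)) (s≤s (m≤m+n a b)))

unpair₁-pair : ∀ a b → unpair₁ (pair a b) ≡ a
unpair₁-pair a b = begin
  pair a b ∸ triangle (diagonal (pair a b)) ≡⟨ cong (λ d → pair a b ∸ triangle d) (diagonal-pair a b) ⟩
  triangle (a + b) + a ∸ triangle (a + b)   ≡⟨ m+n∸m≡n (triangle (a + b)) a ⟩
  a                                         ∎
  where open ≡-Reasoning

unpair₂-pair : ∀ a b → unpair₂ (pair a b) ≡ b
unpair₂-pair a b = begin
  diagonal (pair a b) ∸ unpair₁ (pair a b) ≡⟨ cong₂ _∸_ (diagonal-pair a b) (unpair₁-pair a b) ⟩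
  a + b ∸ a                                ≡⟨ m+n∸m≡n a b ⟩
  b                                        ∎
  where open ≡-Reasoning

encode : ∀ {k} → Vec ℕ k → ℕ
encode []       = 0
encode (x ∷ xs) = pair x (encode xs)

decode : ∀ k → ℕ → Vec ℕ k
decode zero    z = []
decode (suc k) z = unpair₁ z ∷ decode k (unpair₂ z)

decode-encode : ∀ {k} (xs : Vec ℕ k) → decode k (encode xs) ≡ xs
decode-encode []       = refl
decode-encode (x ∷ xs) =
  cong₂ _∷_ (unpair₁-pair x (encode xs))
            (trans (cong (decode _) (unpair₂-pair x (encode xs))) (decode-encode xs))

triangle-code : TotalRecursive 1 (fun₁ triangle)
triangle-code = iteration triangle {h = λ n t → t + suc n} refl (λ _ → refl)
                  (+-code ∘₂⟨ arg₁ , succ-code ∘₁ arg₀ ⟩)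

diagonal-code : TotalRecursive 1 (fun₁ diagonal)
diagonal-code = iteration diagonal {h = λ z d → d + eq (triangle (suc d)) (suc z)} refl (λ _ → refl)
                  (+-code ∘₂⟨ arg₁ , eq-code ∘₂⟨ triangle-code ∘₁ (succ-code ∘₁ arg₁) , succ-code ∘₁ arg₀ ⟩ ⟩)

pair-code : TotalRecursive 2 (fun₂ pair)
pair-code = +-code ∘₂⟨ triangle-code ∘₁ (+-code ∘₂⟨ arg₀ , arg₁ ⟩) , arg₀ ⟩

unpair₁-code : TotalRecursive 1 (fun₁ unpair₁)
unpair₁-code = ∸-code ∘₂⟨ arg₀ , triangle-code ∘₁ diagonal-code ⟩

unpair₂-code : TotalRecursive 1 (fun₁ unpair₂)
unpair₂-code = ∸-code ∘₂⟨ diagonal-code , unpair₁-code ⟩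

decode-code : ∀ k (i : Fin k) → TotalRecursive 1 (fun₁ λ z → lookup (decode k z) i)
decode-code (suc k) zero    = unpair₁-code
decode-code (suc k) (suc i) = decode-code k i ∘₁ unpair₂-code

encodeRest-code : ∀ k → TotalRecursive (suc k) (λ v → encode (tail v))
encodeRest-code zero    = cast (const-code 0) λ { (w ∷ []) → refl }
encodeRest-code (suc k) = cast (pair-code ∘₂⟨ arg₁ , dropFirst (encodeRest-code k) ⟩)
                            λ { (w ∷ x ∷ xs) → refl }

LeastZero : (ℕ → ℕ) → ℕ → Set
LeastZero h w = h w ≡ 0 × (∀ m → m < w → Σ ℕ λ u → h m ≡ suc u)

search-below : (h : ℕ → ℕ) → ∀ n →
  (∀ m → m < n → Σ ℕ λ u → h m ≡ suc u) ⊎ Σ ℕ (LeastZero h)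
search-below h zero = inj₁ (λ m ())
search-below h (suc n) with search-below h n
... | inj₂ found = inj₂ found
... | inj₁ positive with h n in hn≡
...   | zero  = inj₂ (n , hn≡ , positive)
...   | suc u = inj₁ positive′
  where
  positive′ : ∀ m → m < suc n → Σ ℕ λ u → h m ≡ suc u
  positive′ m m<1+n with m<1+n⇒m<n∨m≡n m<1+n
  ... | inj₁ m<n  = positive m m<n
  ... | inj₂ refl = u , hn≡

least-zero : (h : ℕ → ℕ) {w : ℕ} → h w ≡ 0 → Σ ℕ (LeastZero h)
least-zero h {w} hw≡0 with search-below h (suc w)
... | inj₂ found    = found
... | inj₁ positive = ⊥-elim (0≢1+n (trans (sym hw≡0) (proj₂ (positive w (n<1+n w)))))

search-computes : ∀ {o k A} {f : Graph k} {h : Vec ℕ (suc k) → ℕ} {out : ℕ → ℕ}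
  (test : Code o (suc k)) (output : Code o 1) →
  ⟦ test ⟧ A ≈ graphOf h → ⟦ output ⟧ A ≈ graphOf (fun₁ out) → Functional f →
  (∀ w xs → h (w ∷ xs) ≡ 0 → f xs (out w)) →
  (∀ xs y → f xs y → Σ ℕ λ w → h (w ∷ xs) ≡ 0) →
  ⟦ comp output (λ _ → mu test) ⟧ A ≈ f
search-computes {f = f} {h} {out} test output test≈h output≈out functional sound complete xs y =
  mk⇔ forward backward
  where
  forward : ⟦ comp output (λ _ → mu test) ⟧ _ xs y → f xs y
  forward ((w ∷ []) , found , out-y) =
    subst (f xs) (sym (to (output≈out _ y) out-y))
          (sound w xs (sym (to (test≈h _ 0) (proj₁ (found zero)))))
  backward : f xs y → ⟦ comp output (λ _ → mu test) ⟧ _ xs y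
  backward f-y with least-zero (λ w → h (w ∷ xs)) (proj₂ (complete xs y f-y))
  ... | w , zero-w , positive =
    (w ∷ []) ,
    (λ { zero → from (test≈h _ 0) (sym zero-w) ,
                λ m m<w → proj₁ (positive m m<w) , from (test≈h _ _) (sym (proj₂ (positive m m<w))) }) ,
    from (output≈out _ y) (functional xs y (out w) f-y (sound w xs zero-w))

module ClosedClass (lem : ExcludedMiddle 0ℓ) (K : Class)
                   (isClass : IsClassOfPartialFunctions K) (closure : Closure K) where

  functional : ∀ {k} {f : Graph k} → K k f → Functional f
  functional = proj₁ isClass _ _

  respects : ∀ {k} {f g : Graph k} → f ≈ g → K k f → K k g
  respects = proj₂ isClass _ _ _

  recursive∈K : ∀ {k} {f : Graph k} → PartialRecursive f → K k f
  recursive∈K = proj₁ closure _ _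

  comp∈K : ∀ {m k} {f : Graph m} {gs : Fin m → Graph k} →
    K m f → (∀ i → K k (gs i)) → K k (Compose f gs)
  comp∈K = proj₁ (proj₂ closure) _ _ _ _

  primRec∈K : ∀ {k} {f : Graph k} {g : Graph (suc (suc k))} → K k f → K (suc (suc k)) g →
    K (suc k) (PrimRec f g)
  primRec∈K = proj₁ (proj₂ (proj₂ closure)) _ _ _

  mu∈K : ∀ {k} {f : Graph (suc k)} → K (suc k) f → K k (Mu f)
  mu∈K = proj₂ (proj₂ (proj₂ closure)) _ _

  Total∈K : ∀ k → (Vec ℕ k → ℕ) → Set
  Total∈K k φ = K k (graphOf φ)

  totalRecursive∈K : ∀ {k φ} → TotalRecursive k φ → Total∈K k φ
  totalRecursive∈K {k} {φ} t = recursive∈K (code oracleFree , λ A → computes oracleFree A tt)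
    where
    oracleFree : TotalCode false (λ _ → ⊤) k φ
    oracleFree = t

  substitute∈K : ∀ {m k} {f : Graph m} {ψ : Fin m → Vec ℕ k → ℕ} →
    K m f → (∀ i → Total∈K k (ψ i)) → K k (λ xs y → f (tabulate λ i → ψ i xs) y)
  substitute∈K {f = f} f∈K ψ∈K = respects (compose-total f (λ i → ≈-refl)) (comp∈K f∈K ψ∈K)

  _∘K₁_ : ∀ {k} {f : Graph 1} {g : Vec ℕ k → ℕ} →
    K 1 f → Total∈K k g → K k (λ xs y → f (g xs ∷ []) y)
  _∘K₁_ {g = g} f∈K g∈K = substitute∈K {ψ = args₁ g} f∈K λ { zero → g∈K }

  _∘K₂⟨_,_⟩ : ∀ {k} {f : Graph 2} {g h : Vec ℕ k → ℕ} →
    K 2 f → Total∈K k g → Total∈K k h → K k (λ xs y → f (g xs ∷ h xs ∷ []) y)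
  _∘K₂⟨_,_⟩ {g = g} {h} f∈K g∈K h∈K =
    substitute∈K {ψ = args₂ g h} f∈K λ { zero → g∈K ; (suc zero) → h∈K }

  χ : (ℕ → Set) → ℕ → ℕ
  χ S m = truthValue (lem {S m})

  χ-truth : ∀ S m → Truth (S m) (χ S m)
  χ-truth S m = truthValue-truth lem

  χ∈K : ∀ {S} → K 1 (Indicator S) → Total∈K 1 (fun₁ (χ S))
  χ∈K {S} = respects (indicator-truth (χ-truth S))

  code∈K : ∀ {B} → K 1 (Indicator B) → ∀ {k} (c : Code true k) → K k (⟦ c ⟧ B)
  code∈K IB∈K zer         = recursive∈K (zer , λ A → ≈-refl)
  code∈K IB∈K succ        = recursive∈K (succ , λ A → ≈-refl)
  code∈K IB∈K (proj i)    = recursive∈K (proj i , λ A → ≈-refl)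
  code∈K IB∈K (comp f gs) = comp∈K (code∈K IB∈K f) (λ i → code∈K IB∈K (gs i))
  code∈K IB∈K (prec f g)  = primRec∈K (code∈K IB∈K f) (code∈K IB∈K g)
  code∈K IB∈K (mu f)      = mu∈K (code∈K IB∈K f)
  code∈K IB∈K oracle      = IB∈K

  recursiveIn⇒K : ∀ {B} → K 1 (Indicator B) → ∀ {k} {f : Graph k} → RecursiveIn B f → K k f
  recursiveIn⇒K IB∈K (c , c≈f) = respects c≈f (code∈K IB∈K c)

  -- Totalisation: a unary β ∈ K that is defined on a set D with indicator in K
  -- agrees on D with a total function β̂ ∈ K, namely β on D and 0 outside.
  module Totalise {D : ℕ → Set} (ID∈K : K 1 (Indicator D)) (β : Graph 1) (β∈K : K 1 β)
                  (defined : ∀ m → D m → Σ ℕ λ v → β (m ∷ []) v) where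

    select : ∀ m → Dec (D m) → ℕ
    select m (yes d) = proj₁ (defined m d)
    select m (no _)  = 0

    β̂ : ℕ → ℕ
    β̂ m = select m lem

    β̂-agrees : ∀ m → D m → β (m ∷ []) (β̂ m)
    β̂-agrees m d with lem {D m}
    ... | yes d′ = proj₂ (defined m d′)
    ... | no ¬d  = ⊥-elim (¬d d)

    -- By primitive recursion P(0, m) = 0 and P(c + 1, m) = β(m), so that
    -- β̂(m) = P(χ D m, m).
    P : Graph 2
    P = PrimRec ZeroF (Compose β (args₁ (Proj (suc (suc zero)))))

    P∈K : K 2 P
    P∈K = primRec∈K (recursive∈K (zer , λ A → ≈-refl))
            (comp∈K {gs = args₁ (Proj (suc (suc zero)))} β∈K
               λ { zero → recursive∈K (proj (suc (suc zero)) , λ A → ≈-refl) })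

    P-select : ∀ m (d : Dec (D m)) y → P (truthValue d ∷ m ∷ []) y ⇔ (y ≡ select m d)
    P-select m (no _)  y = mk⇔ (λ { (pr-zero y≡0) → y≡0 }) pr-zero
    P-select m (yes d) y = mk⇔ forward backward
      where
      forward : P (1 ∷ m ∷ []) y → y ≡ proj₁ (defined m d)
      forward (pr-suc (pr-zero _) ((v ∷ []) , v≡m , β-y)) with v≡m zero
      ... | refl = functional β∈K (m ∷ []) y _ β-y (proj₂ (defined m d))
      backward : y ≡ proj₁ (defined m d) → P (1 ∷ m ∷ []) y
      backward refl = pr-suc (pr-zero refl) ((m ∷ []) , (λ { zero → refl }) , proj₂ (defined m d))

    β̂∈K : Total∈K 1 (fun₁ β̂)
    β̂∈K = respects (λ { (m ∷ []) y → P-select m lem y })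
                   (P∈K ∘K₂⟨ χ∈K ID∈K , totalRecursive∈K arg₀ ⟩)

module Construction (lem : ExcludedMiddle 0ℓ) (K : Class)
                    (isClass : IsClassOfPartialFunctions K) (closure : Closure K)
                    (F : Graph 2) (F∈K : K 2 F)
                    (universal : ∀ (f : Graph 1) → K 1 f →
                                   Σ ℕ λ n → ∀ x y → f (x ∷ []) y ⇔ F (n ∷ x ∷ []) y) where
  open ClosedClass lem K isClass closure

  U : Graph 1
  U xs y = F (unpair₁ (head xs) ∷ unpair₂ (head xs) ∷ []) y

  U∈K : K 1 U
  U∈K = F∈K ∘K₂⟨ totalRecursive∈K unpair₁-code , totalRecursive∈K unpair₂-code ⟩

  U-pair : ∀ a b y → U (pair a b ∷ []) y ⇔ F (a ∷ b ∷ []) y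
  U-pair a b y rewrite unpair₂-pair a b | unpair₁-pair a b = ⇔-id _

  module Oracle (M : ℕ → Set) (α ω : Graph 1) (α∈K : K 1 α) (ω∈K : K 1 ω)
                (α-defined : ∀ m → M m → Σ ℕ λ v → α (m ∷ []) v)
                (ω-defined : ∀ m → M m → Σ ℕ λ v → ω (m ∷ []) v)
                (IM∈K : K 1 (Indicator M))
                (records : ∀ x y → U (x ∷ []) y ⇔ Σ ℕ λ m → M m × α (m ∷ []) x × ω (m ∷ []) y)
                where
    open Totalise IM∈K α α∈K α-defined
      renaming (β̂ to α̂; β̂-agrees to α̂-agrees; β̂∈K to α̂∈K) using ()
    open Totalise IM∈K ω ω∈K ω-defined
      renaming (β̂ to ω̂; β̂-agrees to ω̂-agrees; β̂∈K to ω̂∈K) using ()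

    triple : ℕ → ℕ → ℕ → ℕ
    triple m e y = pair m (pair e y)

    recordOf inputOf outputOf : ℕ → ℕ
    recordOf w = unpair₁ w
    inputOf  w = unpair₁ (unpair₂ w)
    outputOf w = unpair₂ (unpair₂ w)

    inputOf-code : TotalRecursive 1 (fun₁ inputOf)
    inputOf-code = unpair₁-code ∘₁ unpair₂-code

    outputOf-code : TotalRecursive 1 (fun₁ outputOf)
    outputOf-code = unpair₂-code ∘₁ unpair₂-code

    IsRecord : ℕ → ℕ → ℕ → Set
    IsRecord m e y = M m × α (m ∷ []) e × ω (m ∷ []) y

    A : ℕ → Set
    A w = IsRecord (recordOf w) (inputOf w) (outputOf w)

    A-triple : ∀ {m e y} → IsRecord m e y → A (triple m e y)
    A-triple {m} {e} {y} record-m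
      rewrite unpair₂-pair m (pair e y) | unpair₁-pair m (pair e y)
            | unpair₂-pair e y | unpair₁-pair e y = record-m

    inputOf-triple : ∀ m e y → inputOf (triple m e y) ≡ e
    inputOf-triple m e y rewrite unpair₂-pair m (pair e y) = unpair₁-pair e y

    totalised-record : ∀ m e y → (M m × α̂ m ≡ e × ω̂ m ≡ y) ⇔ IsRecord m e y
    totalised-record m e y = mk⇔
      (λ { (M-m , refl , refl) → M-m , α̂-agrees m M-m , ω̂-agrees m M-m })
      (λ { (M-m , α-e , ω-y) → M-m , functional α∈K _ _ _ (α̂-agrees m M-m) α-e
                                   , functional ω∈K _ _ _ (ω̂-agrees m M-m) ω-y })

    χA : ℕ → ℕ
    χA w = χ M (recordOf w) * (eq (α̂ (recordOf w)) (inputOf w) * eq (ω̂ (recordOf w)) (outputOf w))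

    χA-truth : ∀ w → Truth (A w) (χA w)
    χA-truth w = truth-cong (totalised-record _ _ _)
      (truth-× (χ-truth M _) (truth-× (eq-truth _ _) (eq-truth _ _)))

    χA∈K : Total∈K 1 (fun₁ χA)
    χA∈K = totalRecursive∈K *-code ∘K₂⟨ inM∈K , totalRecursive∈K *-code ∘K₂⟨ inputTest∈K , outputTest∈K ⟩ ⟩
      where
      recordOf∈K : Total∈K 1 (fun₁ recordOf)
      recordOf∈K = totalRecursive∈K unpair₁-code
      inM∈K : Total∈K 1 (fun₁ λ w → χ M (recordOf w))
      inM∈K = χ∈K IM∈K ∘K₁ recordOf∈K
      inputTest∈K : Total∈K 1 (fun₁ λ w → eq (α̂ (recordOf w)) (inputOf w))
      inputTest∈K = totalRecursive∈K eq-code ∘K₂⟨ α̂∈K ∘K₁ recordOf∈K , totalRecursive∈K inputOf-code ⟩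
      outputTest∈K : Total∈K 1 (fun₁ λ w → eq (ω̂ (recordOf w)) (outputOf w))
      outputTest∈K = totalRecursive∈K eq-code ∘K₂⟨ ω̂∈K ∘K₁ recordOf∈K , totalRecursive∈K outputOf-code ⟩

    IA∈K : K 1 (Indicator A)
    IA∈K = respects (≈-sym (indicator-truth χA-truth)) χA∈K

    oracle-code : TotalCode true (_≡ A) 1 (fun₁ χA)
    oracle-code = record { code = oracle ; computes = λ { _ refl → indicator-truth χA-truth } }

    module Search {k} (f : Graph k) (f∈K : K k f) where

      f∘decode : Graph 1
      f∘decode zs y = f (decode k (head zs)) y

      f∘decode∈K : K 1 f∘decode
      f∘decode∈K = respects
        (λ zs y → subst (λ v → f v y ⇔ f∘decode zs y) (sym (tabulate∘lookup _)) (⇔-id _))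
        (substitute∈K f∈K λ i → totalRecursive∈K (decode-code k i))

      program : ℕ
      program = proj₁ (universal f∘decode f∘decode∈K)

      program-spec : ∀ xs y → f xs y ⇔ U (pair program (encode xs) ∷ []) y
      program-spec xs y =
        ⇔-sym (U-pair program (encode xs) y)
          ⇔-∘ (proj₂ (universal f∘decode f∘decode∈K) (encode xs) y
          ⇔-∘ subst (λ v → f xs y ⇔ f v y) (sym (decode-encode xs)) (⇔-id _))

      Witness : Vec ℕ k → ℕ → Set
      Witness xs w = A w × inputOf w ≡ pair program (encode xs)

      test : Vec ℕ (suc k) → ℕ
      test v = χA (head v) * eq (inputOf (head v)) (pair program (encode (tail v)))

      test-truth : ∀ w xs → Truth (Witness xs w) (test (w ∷ xs))
      test-truth w xs = truth-× (χA-truth w) (eq-truth _ _)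

      search-code : TotalCode true (_≡ A) (suc k) (λ v → 1 ∸ test v)
      search-code = ∸-code ∘₂⟨ const-code 1
                             , *-code ∘₂⟨ oracle-code ∘₁ arg₀
                                        , eq-code ∘₂⟨ inputOf-code ∘₁ arg₀
                                                    , pair-code ∘₂⟨ const-code program , encodeRest-code k ⟩ ⟩ ⟩ ⟩

      sound : ∀ w xs → Witness xs w → f xs (outputOf w)
      sound w xs (record-w , input≡) =
        from (program-spec xs (outputOf w)) (subst (λ e → U (e ∷ []) (outputOf w)) input≡
             (from (records (inputOf w) (outputOf w)) (recordOf w , record-w)))

      complete : ∀ xs y → f xs y → Σ ℕ (Witness xs)
      complete xs y f-y = witness (to (records input y) (to (program-spec xs y) f-y))
        where
        input : ℕ
        input = pair program (encode xs)
        witness : (Σ ℕ λ m → IsRecord m input y) → Σ ℕ (Witness xs)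
        witness (m , record-m) = triple m input y , A-triple record-m , inputOf-triple m input y

      output-code : TotalCode true (_≡ A) 1 (fun₁ outputOf)
      output-code = outputOf-code

      code-for-f : Code true k
      code-for-f = comp (code output-code) (λ _ → mu (code search-code))

      computes-f : ⟦ code-for-f ⟧ A ≈ f
      computes-f = search-computes (code search-code) (code output-code)
        (computes search-code A refl) (computes output-code A refl) (functional f∈K)
        (λ w xs zero-w → sound w xs (to (truth-search (test-truth w xs)) zero-w))
        (λ xs y f-y → let (w , witness) = complete xs y f-y
                      in w , from (truth-search (test-truth w xs)) witness)

    characterisation : ∀ k (f : Graph k) → K k f ⇔ RecursiveIn A f
    characterisation k f =
      mk⇔ (λ f∈K → Search.code-for-f f f∈K , Search.computes-f f f∈K) (recursiveIn⇒K IA∈K)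

  oracle-exists : ComputationRecords K →
    Σ (ℕ → Set) λ A → ∀ (k : ℕ) (f : Graph k) → K k f ⇔ RecursiveIn A f
  oracle-exists computationRecords =
    let (M , α , ω , α∈K , ω∈K , α-defined , ω-defined , IM∈K , records) = computationRecords U U∈K
        open Oracle M α ω α∈K ω∈K α-defined ω-defined IM∈K records
    in A , characterisation

mainTheorem1 : ExcludedMiddle 0ℓ → (K : Class) → IsClassOfPartialFunctions K →
    Closure K → ComputationRecords K → Programs K →
    Σ (ℕ → Set) λ A → ∀ (k : ℕ) (f : Graph k) → K k f ⇔ RecursiveIn A f
mainTheorem1 lem K isClass closure computationRecords (F , F∈K , universal) =
  oracle-exists computationRecords
  where open Construction lem K isClass closure F F∈K universal
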